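{- Let $d$ be a positive integer and let $\Phi = \bigwedge_{i=1}^{m} \phi_i$ be a finite conjunction in which each $\phi_i$ is either an equation $f_i = g_i$ or an inequation $f_i \neq g_i$, where $f_i, g_i \in \mathbb{Z}_{2^d}[x_1,\dots,x_n]$. For each $i$ define $h_i := f_i - g_i$ if $\phi_i$ is an equation, and $h_i := z_i\,(f_i - g_i) - 2^{d-1}$ if $\phi_i$ is an inequation, where the $z_i$ are fresh pairwise distinct variables not among $x_1,\dots,x_n$. Let $H = \{h_1,\dots,h_m\}$, viewed as a subset of the polynomial ring over $\mathbb{Z}_{2^d}$ in the variables $x_1,\dots,x_n$ together with all the fresh variables $z_i$. Then $\Phi$ is satisfiable (i.e., there exists $\mathbf{v}\in\mathbb{Z}_{2^d}^n$ making every $\phi_i$ true, with all arithmetic in $\mathbb{Z}_{2^d}$) if and only if $\mathcal{V}(H)$ is non-empty.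
   Context: $\mathbb{Z}_{2^d}$ is the ring of integers modulo $2^d$. For a set $F$ of polynomials over a ring $R$ in variables $y_1,\dots,y_k$, the variety $\mathcal{V}(F) := \{\mathbf{v} \in R^k : f(\mathbf{v}) = 0 \text{ for all } f \in F\}$ is the set of common roots in $R^k$. -}

module Defs where

open import Data.Nat using (ℕ; _+_; _*_; _∸_; _^_; NonZero)
open import Data.Nat.DivMod using (_%_; m%n<n)
open import Data.Nat.Properties using (m^n≢0)
open import Data.Fin using (Fin; toℕ; fromℕ<; _↑ˡ_; _↑ʳ_)
open import Data.Product using (∃)
open import Relation.Binary.PropositionalEquality using (_≡_; _≢_)

modulus : ℕ → ℕ
modulus d = 2 ^ d

modulus-nonzero : ∀ d → NonZero (modulus d)
modulus-nonzero d = m^n≢0 2 d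

record ℤ₂^ (d : ℕ) : Set where
  constructor ⟨_⟩
  field val : Fin (modulus d)
open ℤ₂^ public

[_]_ : ℕ → (d : ℕ) → ℤ₂^ d
[ x ] d = ⟨ fromℕ< {n = modulus d} (m%n<n x (modulus d) {{modulus-nonzero d}}) ⟩

module _ {d : ℕ} where
  _+ᵣ_ : ℤ₂^ d → ℤ₂^ d → ℤ₂^ d
  a +ᵣ b = [ toℕ (val a) + toℕ (val b) ] d

  _*ᵣ_ : ℤ₂^ d → ℤ₂^ d → ℤ₂^ d
  a *ᵣ b = [ toℕ (val a) * toℕ (val b) ] d

  -ᵣ_ : ℤ₂^ d → ℤ₂^ d
  -ᵣ a = [ modulus d ∸ toℕ (val a) ] d

  _-ᵣ_ : ℤ₂^ d → ℤ₂^ d → ℤ₂^ d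
  a -ᵣ b = a +ᵣ (-ᵣ b)

  0ᵣ : ℤ₂^ d
  0ᵣ = [ 0 ] d

-- Polynomials over ℤ_{2^d} in k variables (indexed by Fin k), as expressions.
-- Only their evaluation matters for varieties and satisfiability.
data Poly (d k : ℕ) : Set where
  var  : Fin k → Poly d k
  con  : ℤ₂^ d → Poly d k
  _⊕_  : Poly d k → Poly d k → Poly d k
  _⊗_  : Poly d k → Poly d k → Poly d k
  ⊝_   : Poly d k → Poly d k

_⊖_ : ∀ {d k} → Poly d k → Poly d k → Poly d k
p ⊖ q = p ⊕ (⊝ q)

eval : ∀ {d k} → (Fin k → ℤ₂^ d) → Poly d k → ℤ₂^ d
eval ρ (var i) = ρ i
eval ρ (con c) = c
eval ρ (p ⊕ q) = eval ρ p +ᵣ eval ρ q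
eval ρ (p ⊗ q) = eval ρ p *ᵣ eval ρ q
eval ρ (⊝ p)   = -ᵣ eval ρ p

rename : ∀ {d k l} → (Fin k → Fin l) → Poly d k → Poly d l
rename σ (var i) = var (σ i)
rename σ (con c) = con c
rename σ (p ⊕ q) = rename σ p ⊕ rename σ q
rename σ (p ⊗ q) = rename σ p ⊗ rename σ q
rename σ (⊝ p)   = ⊝ rename σ p

𝒱 : ∀ {d k m} → (Fin m → Poly d k) → (Fin k → ℤ₂^ d) → Set
𝒱 F v = ∀ i → eval v (F i) ≡ 0ᵣ

data Constraint (d n : ℕ) : Set where
  _≐_ : Poly d n → Poly d n → Constraint d n
  _≠_ : Poly d n → Poly d n → Constraint d n

Holds : ∀ {d n} → (Fin n → ℤ₂^ d) → Constraint d n → Set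
Holds v (f ≐ g) = eval v f ≡ eval v g
Holds v (f ≠ g) = eval v f ≢ eval v g

Satisfiable : ∀ {d n m} → (Fin m → Constraint d n) → Set
Satisfiable {d} {n} Φ = ∃ λ (v : Fin n → ℤ₂^ d) → ∀ i → Holds v (Φ i)

-- Variables of the extended ring: x_j = var (j ↑ˡ m), z_i = var (n ↑ʳ i)
module _ {d n m : ℕ} where
  xlift : Poly d n → Poly d (n + m)
  xlift = rename (_↑ˡ m)

  zvar : Fin m → Poly d (n + m)
  zvar i = var (n ↑ʳ i)

  hpoly : Fin m → Constraint d n → Poly d (n + m)
  hpoly i (f ≐ g) = xlift f ⊖ xlift g
  hpoly i (f ≠ g) = (zvar i ⊗ (xlift f ⊖ xlift g)) ⊖ con ([ 2 ^ (d ∸ 1) ] d)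

  H : (Fin m → Constraint d n) → Fin m → Poly d (n + m)
  H Φ i = hpoly i (Φ i)

{-# OPTIONS --safe #-}
module Submission where

-- An equation f = g becomes f - g = 0.  An inequation f ≠ g becomes
-- z (f - g) = 2^(d-1), which is solvable in z exactly when f - g ≠ 0: a nonzero
-- residue is 2^k u with u odd and k < d, so 2^(d-1-k) times it is 2^(d-1),
-- whereas z · 0 = 0 ≠ 2^(d-1).  The z-values are chosen independently per
-- constraint, and restricting a root to the x-variables gives a solution of Φ.

open import Defs
open import Data.Nat using (ℕ; zero; suc; _+_; _*_; _∸_; _^_; _≤_; _<_; NonZero; s≤s; z<s)
open import Data.Nat.Properties
open import Data.Nat.DivMod using (_%_; %-distribˡ-+; %-distribˡ-*; [m+n]%n≡m%n; [m+kn]%n≡m%n; m<n⇒m%n≡m)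
open import Data.Nat.Tactic.RingSolver using (solve-∀)
open import Data.Fin using (Fin; toℕ; _↑ˡ_; _↑ʳ_)
open import Data.Fin.Properties using (toℕ-fromℕ<; toℕ-injective; toℕ<n)
open import Data.Vec.Functional using (_++_)
open import Data.Vec.Functional.Properties using (lookup-++ˡ; lookup-++ʳ)
open import Data.Product using (∃; ∃₂; _,_; proj₁; proj₂)
open import Function using (_∘_)
open import Function.Bundles using (_⇔_; mk⇔)
open import Relation.Binary.PropositionalEquality hiding ([_])

data EvenOdd : ℕ → Set where
  even : ∀ k → EvenOdd (k * 2)
  odd  : ∀ k → EvenOdd (1 + k * 2)

evenOdd : ∀ n → EvenOdd n
evenOdd zero = even 0
evenOdd (suc n) with evenOdd n
... | even k = odd k
... | odd k  = even (suc k)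

2^n<2^[1+n] : ∀ n → 2 ^ n < 2 ^ suc n
2^n<2^[1+n] n = ^-monoʳ-< 2 ≤-refl (n<1+n n)

-- For x = 2^k (1 + 2t) the multiplier is z = 2^(e - k); the induction peels
-- off the factors 2 of x one at a time.
∃z*x≡2^e+q*2^[1+e] : ∀ e x → 0 < x → x < 2 ^ suc e →
                     ∃₂ λ z q → z * x ≡ 2 ^ e + q * 2 ^ suc e
∃z*x≡2^e+q*2^[1+e] e x _ _ with evenOdd x
∃z*x≡2^e+q*2^[1+e] e .(1 + k * 2) _ _ | odd k =
  2 ^ e , k , odd-multiple (2 ^ e) k
  where
  odd-multiple : ∀ P k → P * (1 + k * 2) ≡ P + k * (2 * P)
  odd-multiple = solve-∀
∃z*x≡2^e+q*2^[1+e] zero .(suc k * 2) _ (s≤s (s≤s ())) | even (suc k)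
∃z*x≡2^e+q*2^[1+e] (suc e) .(suc k * 2) _ 2k<2^[2+e] | even (suc k)
  with ∃z*x≡2^e+q*2^[1+e] e (suc k) z<s k<2^[1+e]
  where
  k<2^[1+e] : suc k < 2 ^ suc e
  k<2^[1+e] = *-cancelʳ-< 2 (suc k) (2 ^ suc e) (subst (suc k * 2 <_) (*-comm 2 (2 ^ suc e)) 2k<2^[2+e])
... | z , q , z*k≡ = z , q , (begin
  z * (suc k * 2)            ≡⟨ *-assoc z (suc k) 2 ⟨
  z * suc k * 2              ≡⟨ cong (_* 2) z*k≡ ⟩
  (P + q * (2 * P)) * 2      ≡⟨ double P q ⟩
  2 * P + q * (2 * (2 * P))  ∎)
  where
  open ≡-Reasoning
  P = 2 ^ e
  double : ∀ P q → (P + q * (2 * P)) * 2 ≡ 2 * P + q * (2 * (2 * P))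
  double = solve-∀

module _ {d : ℕ} where
  private
    N : ℕ
    N = modulus d
    instance
      N≢0 : NonZero N
      N≢0 = modulus-nonzero d

  residue : ℤ₂^ d → ℕ
  residue = toℕ ∘ val

  residue-injective : ∀ {a b} → residue a ≡ residue b → a ≡ b
  residue-injective = cong ⟨_⟩ ∘ toℕ-injective

  residue<modulus : ∀ a → residue a < N
  residue<modulus = toℕ<n ∘ val

  residue-[] : ∀ m → residue ([ m ] d) ≡ m % N
  residue-[] m = toℕ-fromℕ< _

  residue-0ᵣ : residue (0ᵣ {d}) ≡ 0
  residue-0ᵣ = trans (residue-[] 0) (m<n⇒m%n≡m (m^n>0 2 d))

  []-cong : ∀ {m n} → m % N ≡ n % N → [ m ] d ≡ [ n ] d
  []-cong {m} {n} eq = residue-injective (trans (residue-[] m) (trans eq (sym (residue-[] n))))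

  []-residue : ∀ a → [ residue a ] d ≡ a
  []-residue a = residue-injective (trans (residue-[] _) (m<n⇒m%n≡m (residue<modulus a)))

  []-+ᵣ : ∀ m n → ([ m ] d) +ᵣ ([ n ] d) ≡ [ m + n ] d
  []-+ᵣ m n = []-cong (trans (cong₂ (λ a b → (a + b) % N) (residue-[] m) (residue-[] n))
                             (sym (%-distribˡ-+ m n N)))

  []-*ᵣ : ∀ m n → ([ m ] d) *ᵣ ([ n ] d) ≡ [ m * n ] d
  []-*ᵣ m n = []-cong (trans (cong₂ (λ a b → (a * b) % N) (residue-[] m) (residue-[] n))
                             (sym (%-distribˡ-* m n N)))

  +ᵣ-identityˡ : ∀ a → 0ᵣ +ᵣ a ≡ a
  +ᵣ-identityˡ a = trans (cong (λ r → [ r + residue a ] d) residue-0ᵣ) ([]-residue a)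

  *ᵣ-zeroʳ : ∀ a → a *ᵣ 0ᵣ ≡ 0ᵣ
  *ᵣ-zeroʳ a = trans (cong (λ r → [ residue a * r ] d) residue-0ᵣ) (cong ([_] d) (*-zeroʳ (residue a)))

  x-ᵣx≡0ᵣ : ∀ x → x -ᵣ x ≡ 0ᵣ
  x-ᵣx≡0ᵣ x = begin
    x -ᵣ x                      ≡⟨ cong (_+ᵣ ([ N ∸ r ] d)) ([]-residue x) ⟨
    ([ r ] d) +ᵣ ([ N ∸ r ] d)  ≡⟨ []-+ᵣ r (N ∸ r) ⟩
    [ r + (N ∸ r) ] d           ≡⟨ cong ([_] d) (m+[n∸m]≡n (<⇒≤ (residue<modulus x))) ⟩
    [ N ] d                     ≡⟨ []-cong ([m+n]%n≡m%n 0 N) ⟩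
    0ᵣ                          ∎
    where
    open ≡-Reasoning
    r = residue x

  -ᵣ-+ᵣ-cancel : ∀ x y → (x -ᵣ y) +ᵣ y ≡ x
  -ᵣ-+ᵣ-cancel x y = begin
    (x -ᵣ y) +ᵣ y
      ≡⟨ cong₂ (λ u w → (u +ᵣ ([ N ∸ s ] d)) +ᵣ w) ([]-residue x) ([]-residue y) ⟨
    (([ r ] d) +ᵣ ([ N ∸ s ] d)) +ᵣ ([ s ] d)  ≡⟨ cong (_+ᵣ ([ s ] d)) ([]-+ᵣ r (N ∸ s)) ⟩
    ([ r + (N ∸ s) ] d) +ᵣ ([ s ] d)           ≡⟨ []-+ᵣ (r + (N ∸ s)) s ⟩
    [ r + (N ∸ s) + s ] d                      ≡⟨ cong ([_] d) (+-assoc r (N ∸ s) s) ⟩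
    [ r + ((N ∸ s) + s) ] d                    ≡⟨ cong (λ n → [ r + n ] d) (m∸n+n≡m (<⇒≤ (residue<modulus y))) ⟩
    [ r + N ] d                                ≡⟨ []-cong ([m+n]%n≡m%n r N) ⟩
    [ r ] d                                    ≡⟨ []-residue x ⟩
    x                                          ∎
    where
    open ≡-Reasoning
    r = residue x
    s = residue y

  x-ᵣy≡0ᵣ⇒x≡y : ∀ {x y} → x -ᵣ y ≡ 0ᵣ → x ≡ y
  x-ᵣy≡0ᵣ⇒x≡y {x} {y} eq = begin
    x               ≡⟨ -ᵣ-+ᵣ-cancel x y ⟨
    (x -ᵣ y) +ᵣ y   ≡⟨ cong (_+ᵣ y) eq ⟩
    0ᵣ +ᵣ y         ≡⟨ +ᵣ-identityˡ y ⟩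
    y               ∎
    where open ≡-Reasoning

module _ {e : ℕ} where
  private
    d : ℕ
    d = suc e
    instance
      2^d≢0 : NonZero (2 ^ d)
      2^d≢0 = modulus-nonzero d

  residue-2^e : residue ([ 2 ^ e ] d) ≡ 2 ^ e
  residue-2^e = trans (residue-[] {d} (2 ^ e)) (m<n⇒m%n≡m (2^n<2^[1+n] e))

  2^e≢0ᵣ : [ 2 ^ e ] d ≢ 0ᵣ
  2^e≢0ᵣ eq = <⇒≢ (m^n>0 2 e) (sym (trans (sym residue-2^e) (trans (cong residue eq) (residue-0ᵣ {d}))))

  x≢0ᵣ⇒∃z*ᵣx≡2^e : ∀ {x : ℤ₂^ d} → x ≢ 0ᵣ → ∃ λ z → z *ᵣ x ≡ [ 2 ^ e ] d
  x≢0ᵣ⇒∃z*ᵣx≡2^e {x} x≢0ᵣ with ∃z*x≡2^e+q*2^[1+e] e (residue x) 0<r (residue<modulus x)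
    where
    0<r : 0 < residue x
    0<r = n≢0⇒n>0 (λ r≡0 → x≢0ᵣ (residue-injective (trans r≡0 (sym (residue-0ᵣ {d})))))
  ... | z , q , z*r≡ = [ z ] d , (begin
    ([ z ] d) *ᵣ x                  ≡⟨ cong (([ z ] d) *ᵣ_) ([]-residue x) ⟨
    ([ z ] d) *ᵣ ([ residue x ] d)  ≡⟨ []-*ᵣ z (residue x) ⟩
    [ z * residue x ] d             ≡⟨ cong ([_] d) z*r≡ ⟩
    [ 2 ^ e + q * 2 ^ d ] d         ≡⟨ []-cong ([m+kn]%n≡m%n (2 ^ e) q (2 ^ d)) ⟩
    [ 2 ^ e ] d                     ∎)
    where open ≡-Reasoning

eval-rename : ∀ {d k l} (ρ : Fin l → ℤ₂^ d) (σ : Fin k → Fin l) p →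
              eval ρ (rename σ p) ≡ eval (ρ ∘ σ) p
eval-rename ρ σ (var i) = refl
eval-rename ρ σ (con c) = refl
eval-rename ρ σ (p ⊕ q) = cong₂ _+ᵣ_ (eval-rename ρ σ p) (eval-rename ρ σ q)
eval-rename ρ σ (p ⊗ q) = cong₂ _*ᵣ_ (eval-rename ρ σ p) (eval-rename ρ σ q)
eval-rename ρ σ (⊝ p)   = cong -ᵣ_ (eval-rename ρ σ p)

eval-cong : ∀ {d k} {ρ σ : Fin k → ℤ₂^ d} → ρ ≗ σ → ∀ p → eval ρ p ≡ eval σ p
eval-cong ρ≗σ (var i) = ρ≗σ i
eval-cong ρ≗σ (con c) = refl
eval-cong ρ≗σ (p ⊕ q) = cong₂ _+ᵣ_ (eval-cong ρ≗σ p) (eval-cong ρ≗σ q)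
eval-cong ρ≗σ (p ⊗ q) = cong₂ _*ᵣ_ (eval-cong ρ≗σ p) (eval-cong ρ≗σ q)
eval-cong ρ≗σ (⊝ p)   = cong -ᵣ_ (eval-cong ρ≗σ p)

module _ {d n m : ℕ} {ρ : Fin (n + m) → ℤ₂^ d} {v : Fin n → ℤ₂^ d} (ρ≗v : ρ ∘ (_↑ˡ m) ≗ v) where

  eval-xlift : ∀ p → eval ρ (xlift p) ≡ eval v p
  eval-xlift p = trans (eval-rename ρ (_↑ˡ m) p) (eval-cong ρ≗v p)

  eval-xlift-⊖ : ∀ f g → eval ρ (xlift f ⊖ xlift g) ≡ eval v f -ᵣ eval v g
  eval-xlift-⊖ f g = cong₂ _-ᵣ_ (eval-xlift f) (eval-xlift g)

module _ {e n m : ℕ} where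
  private
    d : ℕ
    d = suc e

  hpoly-root⇒Holds : ∀ (ρ : Fin (n + m) → ℤ₂^ d) i φ →
                     eval ρ (hpoly i φ) ≡ 0ᵣ → Holds (ρ ∘ (_↑ˡ m)) φ
  hpoly-root⇒Holds ρ i (f ≐ g) root = x-ᵣy≡0ᵣ⇒x≡y (trans (sym (eval-xlift-⊖ (λ _ → refl) f g)) root)
  hpoly-root⇒Holds ρ i (f ≠ g) root f≡g = 2^e≢0ᵣ (begin
    [ 2 ^ e ] d   ≡⟨ x-ᵣy≡0ᵣ⇒x≡y root ⟨
    z *ᵣ D        ≡⟨ cong (z *ᵣ_) D≡0ᵣ ⟩
    z *ᵣ 0ᵣ       ≡⟨ *ᵣ-zeroʳ z ⟩
    0ᵣ            ∎)
    where
    open ≡-Reasoning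
    z = ρ (n ↑ʳ i)
    v = ρ ∘ (_↑ˡ m)
    D = eval ρ (xlift f ⊖ xlift g)
    D≡0ᵣ : D ≡ 0ᵣ
    D≡0ᵣ = trans (eval-xlift-⊖ (λ _ → refl) f g) (trans (cong (_-ᵣ eval v g) f≡g) (x-ᵣx≡0ᵣ _))

  Holds⇒hpoly-root : ∀ i (v : Fin n → ℤ₂^ d) φ → Holds v φ →
                     ∃ λ z → ∀ {ρ} → ρ ∘ (_↑ˡ m) ≗ v → ρ (n ↑ʳ i) ≡ z → eval ρ (hpoly i φ) ≡ 0ᵣ
  Holds⇒hpoly-root i v (f ≐ g) f≡g = 0ᵣ , λ ρ≗v _ →
    trans (eval-xlift-⊖ ρ≗v f g) (trans (cong (_-ᵣ eval v g) f≡g) (x-ᵣx≡0ᵣ _))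
  Holds⇒hpoly-root i v (f ≠ g) f≢g = z , λ {ρ} ρ≗v ρz≡z → begin
    (ρ (n ↑ʳ i) *ᵣ eval ρ (xlift f ⊖ xlift g)) -ᵣ ([ 2 ^ e ] d)
      ≡⟨ cong₂ (λ x y → (x *ᵣ y) -ᵣ ([ 2 ^ e ] d)) ρz≡z (eval-xlift-⊖ ρ≗v f g) ⟩
    (z *ᵣ D) -ᵣ ([ 2 ^ e ] d)        ≡⟨ cong (_-ᵣ ([ 2 ^ e ] d)) z*D≡2^e ⟩
    ([ 2 ^ e ] d) -ᵣ ([ 2 ^ e ] d)   ≡⟨ x-ᵣx≡0ᵣ _ ⟩
    0ᵣ                               ∎
    where
    open ≡-Reasoning
    D = eval v f -ᵣ eval v g
    witness = x≢0ᵣ⇒∃z*ᵣx≡2^e (f≢g ∘ x-ᵣy≡0ᵣ⇒x≡y)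
    z = proj₁ witness
    z*D≡2^e = proj₂ witness

proposition2 : (d : ℕ) → 1 ≤ d → (n m : ℕ) → (Φ : Fin m → Constraint d n) →
    Satisfiable Φ ⇔ ∃ (𝒱 (H Φ))
proposition2 (suc e) _ n m Φ = mk⇔ satisfiable⇒root root⇒satisfiable
  where
  satisfiable⇒root : Satisfiable Φ → ∃ (𝒱 (H Φ))
  satisfiable⇒root (v , v⊨Φ) =
    v ++ zs , λ i → proj₂ (witness i) (lookup-++ˡ v zs) (lookup-++ʳ v zs i)
    where
    witness = λ i → Holds⇒hpoly-root i v (Φ i) (v⊨Φ i)
    zs = proj₁ ∘ witness

  root⇒satisfiable : ∃ (𝒱 (H Φ)) → Satisfiable Φ
  root⇒satisfiable (ρ , ρ∈𝒱) = ρ ∘ (_↑ˡ m) , λ i → hpoly-root⇒Holds ρ i (Φ i) (ρ∈𝒱 i)
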